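{- Let $\pi\in S_n$ with pinnacles $y_1,\ldots,y_p$ and dells $v_1,\ldots,v_{p+1}$ (left-to-right order), $y_0=n+1$, $y_{p+1}=n+2$. Let $1\le i\le q\le p+1$ with $v_i\le v_q$, and suppose $u=\mathit{Prec}_\pi(v_i)$ is not a pinnacle and satisfies $y_0\neq u<y_q$. Then there exist two reversals, the first balanced for $\pi$ and the second balanced for the result of the first, transforming $\pi$ into a permutation $\pi''$ such that the only differences between $\pi$ and $\pi''$ are the following: (i) if $u>v_q$, then $u$ is moved to the position immediately after $\mathit{cutA}_\pi(u,v_q,y_q)$, so that $u\in A_{\pi''}(v_q,y_q)$; (ii) if $u<v_q$, then $u$ is moved to the position immediately after $v_q$ and becomes the $q$-th dell $v''_q$ of $\pi''$.
   Context: Convention: a permutation $\pi=(\pi_1\,\ldots\,\pi_n)\in S_n$ is always extended by $\pi_0=n+1$ and $\pi_{n+1}=n+2$. For $1\le j\le n+1$, $\mathit{Prec}_\pi(\pi_j)=\pi_{j-1}$; for $0\le j\le n$, $\mathit{Next}_\pi(\pi_j)=\pi_{j+1}$. A pinnacle is an element $\pi_j$, $1\le j\le n$, with $\pi_{j-1}<\pi_j>\pi_{j+1}$; a dell is an element $\pi_j$, $1\le j\le n$, with $\pi_{j-1}>\pi_j<\pi_{j+1}$. If $\pi$ has $p$ pinnacles it has $p+1$ dells, and in left-to-right order they alternate as $v_1,y_1,v_2,y_2,\ldots,y_p,v_{p+1}$. For $1\le j\le p+1$, the ascending set $A_\pi(v_j,y_j)$ is the set of elements of the block of $\pi$ with endpoints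 $v_j$ and $y_j$ that are neither dells nor pinnacles; for $0\le j\le p$, the descending set $D_\pi(y_j,v_{j+1})$ is defined likewise for the block with endpoints $y_j$ and $v_{j+1}$. For $1\le j\le p+1$ and an element $z\notin A_\pi(v_j,y_j)$ with $v_j<z<y_j$, the cutpoint $\mathit{cutA}_\pi(z,v_j,y_j)$ is the largest element $e\in A_\pi(v_j,y_j)\cup\{v_j\}$ with $e<z$. For elements $w_1=\pi_a$, $w_2=\pi_b$ with $1\le a\le b\le n$, the reversal $\rho(w_1,w_2)$ transforms $\pi$ into $(\pi_0\ldots\pi_{a-1}\,\pi_b\,\pi_{b-1}\ldots\pi_a\,\pi_{b+1}\ldots\pi_{n+1})$; it is balanced for $\pi$ if it does not change the set of pinnacles. -}

module Defs where

open import Data.Nat using (ℕ; zero; suc; _<_; _≤_; _<?_; pred)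
open import Data.Bool using (Bool; _∧_; if_then_else_)
open import Data.List using (List; []; _∷_; _++_; [_]; map; upTo; reverse; filter; length)
open import Data.List.Membership.Propositional using (_∈_; _∉_)
open import Data.List.Relation.Binary.Permutation.Propositional using (_↭_)
open import Data.Maybe using (Maybe; just; nothing)
open import Data.Product using (Σ; ∃; ∃₂; _×_; _,_)
open import Data.Sum using (_⊎_)
open import Relation.Nullary using (does; ¬_; ¬?)
open import Relation.Binary.PropositionalEquality using (_≡_; _≢_)
import Data.Nat as ℕ

one-to-n : ℕ → List ℕ
one-to-n n = map suc (upTo n)

IsPerm : ℕ → List ℕ → Set
IsPerm n π = π ↭ one-to-n n

ext : ℕ → List ℕ → List ℕ
ext n π = suc n ∷ π ++ [ suc (suc n) ]

scan : (ℕ → ℕ → ℕ → Bool) → List ℕ → List ℕ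
scan P (a ∷ t@(b ∷ c ∷ rest)) = (if P a b c then b ∷ [] else []) ++ scan P t
scan P _ = []

pinnacles : ℕ → List ℕ → List ℕ
pinnacles n π = scan (λ a b c → does (a <? b) ∧ does (c <? b)) (ext n π)

dells : ℕ → List ℕ → List ℕ
dells n π = scan (λ a b c → does (b <? a) ∧ does (b <? c)) (ext n π)

nth : {A : Set} → List A → ℕ → Maybe A
nth []       _       = nothing
nth (x ∷ xs) zero    = just x
nth (x ∷ xs) (suc k) = nth xs k

-- v_j (1-indexed, j ≥ 1)
dellNo : ℕ → List ℕ → ℕ → Maybe ℕ
dellNo n π j = nth (dells n π) (pred j)

-- y_j for 0 ≤ j ≤ p+1, with y_0 = n+1 and y_{p+1} = n+2
pinNo : ℕ → List ℕ → ℕ → Maybe ℕ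
pinNo n π j = nth (suc n ∷ pinnacles n π ++ [ suc (suc n) ]) j

Adjacent : ℕ → ℕ → List ℕ → Set
Adjacent a b l = ∃₂ λ xs ys → l ≡ xs ++ a ∷ b ∷ ys

InBlock : ℕ → ℕ → ℕ → List ℕ → Set
InBlock a b z l = Σ (List ℕ) λ xs → Σ (List ℕ) λ ms → Σ (List ℕ) λ ys →
  (l ≡ xs ++ a ∷ ms ++ b ∷ ys) × z ∈ ms

InA : ℕ → List ℕ → ℕ → ℕ → ℕ → Set
InA n σ v y z = InBlock v y z (ext n σ) × z ∉ dells n σ × z ∉ pinnacles n σ

CutA : ℕ → List ℕ → ℕ → ℕ → ℕ → ℕ → Set
CutA n σ z v y e =
  (e ≡ v ⊎ InA n σ v y e) × e < z ×
  (∀ e' → (e' ≡ v ⊎ InA n σ v y e') → e' < z → e' ≤ e)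

Reversal : List ℕ → List ℕ → Set
Reversal σ τ = Σ (List ℕ) λ xs → Σ (List ℕ) λ ms → Σ (List ℕ) λ ys →
  ms ≢ [] × σ ≡ xs ++ ms ++ ys × τ ≡ xs ++ reverse ms ++ ys

-- the reversal σ ↦ τ is balanced: the set of pinnacles is unchanged
SamePinnacles : ℕ → List ℕ → List ℕ → Set
SamePinnacles n σ τ = ∀ x → (x ∈ pinnacles n σ → x ∈ pinnacles n τ) × (x ∈ pinnacles n τ → x ∈ pinnacles n σ)

insertAfter : ℕ → ℕ → List ℕ → List ℕ
insertAfter u e [] = []
insertAfter u e (x ∷ xs) = if does (x ℕ.≟ e) then x ∷ u ∷ xs else x ∷ insertAfter u e xs

moveAfter : ℕ → ℕ → List ℕ → List ℕ
moveAfter u e σ = insertAfter u e (filter (λ x → ¬? (x ℕ.≟ u)) σ)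

module Submission where

-- Write the extended word of π as … w u S z …, where S runs from v_i to e, the largest letter
-- of the ascending run v_q … y_q below u (so e = v_q when u < v_q), and z follows e. The first
-- reversal reverses S, the second reverses u followed by the reversed S; together they move u
-- right after e. Since u < w, v_i < u, e < z and u < z, no letter on the border of the window
-- w S u changes whether it is a pinnacle, so the pinnacles of the three words are A C B, A
-- (reverse C) B and A C B, with C the pinnacles inside the window. If v_q < u the dells do not
-- change either and e = cutA(u, v_q, y_q); if u < v_q then e = v_q, which stops being a dell
-- while u, now between v_q and z, becomes one in its place.

open import Defs
open import Data.Bool using (Bool; true; false; _∧_; if_then_else_)
import Data.Bool as Bool
open import Data.Bool.Properties using (∧-comm; ∧-zeroʳ; ∧-identityʳ; ∧-conicalˡ; ∧-conicalʳ)
open import Data.Empty using (⊥; ⊥-elim)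
open import Data.List using (List; []; _∷_; _++_; [_]; _∷ʳ_; reverse; length; filter)
open import Data.List.Properties
  using (++-assoc; ++-identityʳ; ∷-injective; ∷-injectiveˡ; ∷-injectiveʳ; ∷ʳ-injectiveʳ; ∷ʳ-++;
         filter-++; filter-all; filter-reject; reverse-++; unfold-reverse; reverse-involutive)
open import Data.List.Membership.Propositional using (_∈_; _∉_)
open import Data.List.Membership.Propositional.Properties
  using (∈-++⁺ˡ; ∈-++⁺ʳ; ∈-++⁻; ∈-∃++; ∈-map⁻; ∈-upTo⁻)
open import Data.List.Relation.Binary.Permutation.Propositional using (_↭_; ↭-sym; ↭⇒↭ₛ)
open import Data.List.Relation.Binary.Permutation.Propositional.Properties using (∈-resp-↭; ++⁺ˡ; ++⁺ʳ; ↭-reverse)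
open import Data.List.Relation.Unary.All as All using (All; []; _∷_)
import Data.List.Relation.Unary.All.Properties as Allₚ
open import Data.List.Relation.Unary.AllPairs using ([]; _∷_)
open import Data.List.Relation.Unary.Any using (here; there)
open import Data.List.Relation.Unary.Linked as Linked using (Linked; [-])
open import Data.List.Relation.Unary.Linked.Properties using (Linked⇒All)
open import Data.List.Relation.Unary.Unique.Propositional using (Unique)
open import Data.List.Relation.Unary.Unique.Propositional.Properties using (Unique[x∷xs]⇒x∉xs; map⁺; upTo⁺; ++⁺)
open import Data.Maybe using (just)
open import Data.Nat using (ℕ; zero; suc; _<_; _≤_; _<?_; _≟_; z≤n; s≤s)
open import Data.Nat.Properties
  using (<-asym; <-trans; <-irrefl; <-cmp; ≤-refl; <⇒≤; ≤-antisym; n<1+n; suc-injective; <ᵇ⇒<)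
open import Data.Product using (Σ; ∃; _×_; _,_; proj₁; proj₂)
open import Data.Sum using (_⊎_; inj₁; inj₂; [_,_]′)
open import Data.Unit using (tt)
open import Relation.Binary using (tri<; tri≈; tri>)
open import Relation.Binary.PropositionalEquality
  using (_≡_; _≢_; refl; sym; trans; cong; cong₂; subst; subst₂; setoid; module ≡-Reasoning)
open import Relation.Nullary using (does; ¬?)
open import Relation.Nullary.Decidable using (dec-true; dec-false)
open import Data.List.Relation.Binary.Permutation.Setoid.Properties (setoid ℕ) using (Unique-resp-↭)

module _ {A : Set} where

  last⁺ : A → List A → A
  last⁺ d [] = d
  last⁺ d (x ∷ xs) = last⁺ x xs

  init⁺ : A → List A → List A
  init⁺ d [] = []
  init⁺ d (x ∷ xs) = d ∷ init⁺ x xs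

  init⁺-∷ʳ-last⁺ : ∀ d xs → d ∷ xs ≡ init⁺ d xs ∷ʳ last⁺ d xs
  init⁺-∷ʳ-last⁺ d [] = refl
  init⁺-∷ʳ-last⁺ d (x ∷ xs) = cong (d ∷_) (init⁺-∷ʳ-last⁺ x xs)

  last⁺-++-∷ : ∀ d xs y ys → last⁺ d (xs ++ y ∷ ys) ≡ last⁺ y ys
  last⁺-++-∷ d [] y ys = refl
  last⁺-++-∷ d (x ∷ xs) y ys = last⁺-++-∷ x xs y ys

  last⁺-∈ : ∀ d xs → last⁺ d xs ∈ d ∷ xs
  last⁺-∈ d [] = here refl
  last⁺-∈ d (x ∷ xs) = there (last⁺-∈ x xs)

  ∷ʳ-≡-++-∷ : ∀ xs ys {y c} cs → xs ∷ʳ y ≡ ys ++ c ∷ cs →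
              Σ (List A) λ zs → c ∷ cs ≡ zs ∷ʳ y × xs ≡ ys ++ zs
  ∷ʳ-≡-++-∷ xs [] cs eq = xs , sym eq , refl
  ∷ʳ-≡-++-∷ [] (z ∷ []) cs eq with () ← ∷-injectiveʳ eq
  ∷ʳ-≡-++-∷ [] (z ∷ _ ∷ _) cs eq with () ← ∷-injectiveʳ eq
  ∷ʳ-≡-++-∷ (x ∷ xs) (z ∷ ys) cs eq with refl , eq′ ← ∷-injective eq
    with zs , eq₁ , eq₂ ← ∷ʳ-≡-++-∷ xs ys cs eq′ = zs , eq₁ , cong (x ∷_) eq₂

  nth-∈ : ∀ (xs : List A) k {x} → nth xs k ≡ just x → x ∈ xs
  nth-∈ (y ∷ xs) zero refl = here refl
  nth-∈ (y ∷ xs) (suc k) eq = there (nth-∈ xs k eq)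

  Unique-∉ : ∀ (xs : List A) {x ys} → Unique (xs ++ x ∷ ys) → x ∉ xs × x ∉ ys
  Unique-∉ [] u = (λ ()) , Unique[x∷xs]⇒x∉xs u
  Unique-∉ (z ∷ xs) {x} (z∉ ∷ u) = x∉z∷xs , proj₂ (Unique-∉ xs u)
    where
    x∉z∷xs : x ∉ z ∷ xs
    x∉z∷xs (here refl) = All.lookup z∉ (∈-++⁺ʳ xs (here refl)) refl
    x∉z∷xs (there m) = proj₁ (Unique-∉ xs u) m

  Unique-++ʳ : ∀ (xs : List A) {ys} → Unique (xs ++ ys) → Unique ys
  Unique-++ʳ [] u = u
  Unique-++ʳ (x ∷ xs) (_ ∷ u) = Unique-++ʳ xs u

  Unique-split : ∀ (xs xs′ : List A) {x ys ys′} → Unique (xs ++ x ∷ ys) →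
                 xs ++ x ∷ ys ≡ xs′ ++ x ∷ ys′ → xs ≡ xs′ × ys ≡ ys′
  Unique-split [] [] u eq = refl , ∷-injectiveʳ eq
  Unique-split [] (y ∷ xs′) {x} u eq with refl , eq′ ← ∷-injective eq =
    ⊥-elim (Unique[x∷xs]⇒x∉xs u (subst (x ∈_) (sym eq′) (∈-++⁺ʳ xs′ (here refl))))
  Unique-split (y ∷ xs) [] u eq with refl , _ ← ∷-injective eq =
    ⊥-elim (Unique[x∷xs]⇒x∉xs u (∈-++⁺ʳ xs (here refl)))
  Unique-split (y ∷ xs) (y′ ∷ xs′) (_ ∷ u) eq with refl , eq′ ← ∷-injective eq
    with refl , refl ← Unique-split xs xs′ u eq′ = refl , refl

  nth-replace : ∀ (xs : List A) {x ys} k y → Unique (xs ++ x ∷ ys) → nth (xs ++ x ∷ ys) k ≡ just x →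
                nth (xs ++ y ∷ ys) k ≡ just y
  nth-replace [] zero y _ _ = refl
  nth-replace [] {ys = ys} (suc k) y u eq = ⊥-elim (Unique[x∷xs]⇒x∉xs u (nth-∈ ys k eq))
  nth-replace (z ∷ xs) zero y u refl = ⊥-elim (proj₁ (Unique-∉ (z ∷ xs) u) (here refl))
  nth-replace (z ∷ xs) (suc k) y (_ ∷ u) eq = nth-replace xs k y u eq

  ++-∷-++-∷ : ∀ (P : List A) v Ra x Rb rest →
              P ++ v ∷ (Ra ++ x ∷ Rb) ++ rest ≡ (P ++ v ∷ Ra) ++ x ∷ Rb ++ rest
  ++-∷-++-∷ P v Ra x Rb rest =
    trans (cong (λ t → P ++ v ∷ t) (++-assoc Ra (x ∷ Rb) rest)) (sym (++-assoc P (v ∷ Ra) (x ∷ Rb ++ rest)))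

  init⁺-++-last⁺ : ∀ d xs rest → (d ∷ xs) ++ rest ≡ init⁺ d xs ++ last⁺ d xs ∷ rest
  init⁺-++-last⁺ d xs rest = trans (cong (_++ rest) (init⁺-∷ʳ-last⁺ d xs)) (∷ʳ-++ (init⁺ d xs) (last⁺ d xs) rest)

  ++-∷ʳ-++ : ∀ (L D : List A) x R → L ++ (D ∷ʳ x) ++ R ≡ (L ++ D) ++ x ∷ R
  ++-∷ʳ-++ L D x R = trans (cong (L ++_) (++-assoc D [ x ] R)) (sym (++-assoc L D (x ∷ R)))

  head-∈ : ∀ {b : A} {r} before {v rest} → b ∷ r ≡ before ++ v ∷ rest → b ∈ before ∷ʳ v
  head-∈ [] refl = here refl
  head-∈ (_ ∷ _) refl = here refl

  last-∈ : ∀ bs {l : A} P v Ra → bs ∷ʳ l ≡ P ++ v ∷ Ra → l ∈ v ∷ Ra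
  last-∈ bs {l} P v Ra eq = subst (_∈ v ∷ Ra) l≡ (last⁺-∈ v Ra)
    where
    l≡ : last⁺ v Ra ≡ l
    l≡ = trans (sym (last⁺-++-∷ v P v Ra)) (trans (cong (last⁺ v) (sym eq)) (last⁺-++-∷ v bs l []))

  last⁺-reverse : ∀ (d s : A) S′ → last⁺ d (reverse (s ∷ S′)) ≡ s
  last⁺-reverse d s S′ = trans (cong (last⁺ d) (unfold-reverse s S′)) (last⁺-++-∷ d (reverse S′) s [])

  last⁺-init⁺ : ∀ (a b s : A) S′ → s ≢ last⁺ s S′ → last⁺ a (init⁺ s S′) ≡ last⁺ b (init⁺ s S′)
  last⁺-init⁺ a b s [] s≢s = ⊥-elim (s≢s refl)
  last⁺-init⁺ a b s (x ∷ S′) _ = refl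

  reverse-∷-∷ʳ : ∀ (z : A) S u → reverse (z ∷ S ∷ʳ u) ≡ u ∷ reverse S ∷ʳ z
  reverse-∷-∷ʳ z S u = trans (reverse-++ (z ∷ S) [ u ]) (cong (u ∷_) (unfold-reverse z S))

  reverse-∷-reverse : ∀ (u : A) S → reverse (u ∷ reverse S) ≡ S ∷ʳ u
  reverse-∷-reverse u S = trans (unfold-reverse u (reverse S)) (cong (_∷ʳ u) (reverse-involutive S))

  nth-≡ : ∀ {xs ys : List A} {k y} → xs ≡ ys → nth xs k ≡ just y → nth ys k ≡ just y
  nth-≡ {k = k} {y} eq = subst (λ zs → nth zs k ≡ just y) eq

Linked-All : ∀ {a L} → Linked _<_ (a ∷ L) → All (a <_) L
Linked-All {L = []} _ = []
Linked-All {L = _ ∷ _} (a<b Linked.∷ asc) = Linked⇒All <-trans a<b asc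

Linked-<-around : ∀ xs {x ys} → Linked _<_ (xs ++ x ∷ ys) → All (_< x) xs × All (x <_) ys
Linked-<-around [] asc = [] , Linked-All asc
Linked-<-around (a ∷ xs) asc with below , above ← Linked-<-around xs (Linked.tail asc) =
  All.lookup (Linked-All asc) (∈-++⁺ʳ xs (here refl)) ∷ below , above

∈-∷ʳ-≤ : ∀ {xs x y} → All (_< x) xs → y ∈ xs ∷ʳ x → y ≤ x
∈-∷ʳ-≤ {xs} below m with ∈-++⁻ xs m
... | inj₁ m′ = <⇒≤ (All.lookup below m′)
... | inj₂ (here refl) = ≤-refl

split-below-above : ∀ u R {ys} → Linked _<_ (R ++ ys) → u ∉ R →
                    Σ (List ℕ) λ R₁ → Σ (List ℕ) λ R₂ → R ≡ R₁ ++ R₂ × All (_< u) R₁ × All (u <_) R₂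
split-below-above u [] _ _ = [] , [] , refl , [] , []
split-below-above u (r ∷ R) asc u∉ with <-cmp r u
... | tri≈ _ r≡u _ = ⊥-elim (u∉ (here (sym r≡u)))
... | tri> _ _ u<r = [] , r ∷ R , refl , [] , u<r ∷ All.map (<-trans u<r) (Allₚ.++⁻ˡ R (Linked-All asc))
... | tri< r<u _ _ with R₁ , R₂ , eq , below , above ← split-below-above u R (Linked.tail asc) (λ m → u∉ (there m)) =
  r ∷ R₁ , R₂ , cong (r ∷_) eq , r<u ∷ below , above

Triple : Set
Triple = ℕ → ℕ → ℕ → Bool

middle : Triple → ℕ → ℕ → ℕ → List ℕ
middle P a b c = if P a b c then [ b ] else []

middleAt : Triple → ℕ → List ℕ → List ℕ
middleAt P a (b ∷ c ∷ _) = middle P a b c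
middleAt P a _ = []

scan-∷ : ∀ P x L → scan P (x ∷ L) ≡ middleAt P x L ++ scan P L
scan-∷ P x [] = refl
scan-∷ P x (y ∷ []) = refl
scan-∷ P x (y ∷ w ∷ L) = refl

middleAt-++ : ∀ P x X a b R R′ → middleAt P x (X ++ a ∷ b ∷ R) ≡ middleAt P x (X ++ a ∷ b ∷ R′)
middleAt-++ P x [] a b R R′ = refl
middleAt-++ P x (y ∷ []) a b R R′ = refl
middleAt-++ P x (y ∷ w ∷ X) a b R R′ = refl

scan-skip : ∀ P a b c r → P a b c ≡ false → scan P (a ∷ b ∷ c ∷ r) ≡ scan P (b ∷ c ∷ r)
scan-skip P a b c r eq = cong (λ t → (if t then [ b ] else []) ++ scan P (b ∷ c ∷ r)) eq

scan-keep : ∀ P a b c r → P a b c ≡ true → scan P (a ∷ b ∷ c ∷ r) ≡ b ∷ scan P (b ∷ c ∷ r)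
scan-keep P a b c r eq = cong (λ t → (if t then [ b ] else []) ++ scan P (b ∷ c ∷ r)) eq

scan-split : ∀ P X a b R → scan P (X ++ a ∷ b ∷ R) ≡ scan P (X ++ a ∷ b ∷ []) ++ scan P (a ∷ b ∷ R)
scan-split P [] a b R = refl
scan-split P (x ∷ X) a b R = begin
  scan P (x ∷ X ++ a ∷ b ∷ R)
    ≡⟨ scan-∷ P x (X ++ a ∷ b ∷ R) ⟩
  middleAt P x (X ++ a ∷ b ∷ R) ++ scan P (X ++ a ∷ b ∷ R)
    ≡⟨ cong₂ _++_ (middleAt-++ P x X a b R []) (scan-split P X a b R) ⟩
  middleAt P x (X ++ a ∷ b ∷ []) ++ scan P (X ++ a ∷ b ∷ []) ++ rest
    ≡⟨ ++-assoc (middleAt P x (X ++ a ∷ b ∷ [])) _ _ ⟨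
  (middleAt P x (X ++ a ∷ b ∷ []) ++ scan P (X ++ a ∷ b ∷ [])) ++ rest
    ≡⟨ cong (_++ rest) (scan-∷ P x (X ++ a ∷ b ∷ [])) ⟨
  scan P (x ∷ X ++ a ∷ b ∷ []) ++ rest ∎
  where
  open ≡-Reasoning
  rest = scan P (a ∷ b ∷ R)

scan-∷ʳ : ∀ P X a b c → scan P (X ++ a ∷ b ∷ c ∷ []) ≡ scan P (X ++ a ∷ b ∷ []) ++ middle P a b c
scan-∷ʳ P X a b c = trans (scan-split P X a b (c ∷ [])) (cong (scan P (X ++ a ∷ b ∷ []) ++_) (++-identityʳ (middle P a b c)))

scan-window : ∀ P T a m M b Q →
  scan P (T ++ a ∷ (m ∷ M) ++ b ∷ Q) ≡
  scan P (T ++ a ∷ m ∷ []) ++ scan P (a ∷ (m ∷ M) ∷ʳ b) ++ scan P (last⁺ m M ∷ b ∷ Q)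
scan-window P T a m M b Q = begin
  scan P (T ++ a ∷ m ∷ M ++ b ∷ Q)                             ≡⟨ scan-split P T a m (M ++ b ∷ Q) ⟩
  scan P (T ++ a ∷ m ∷ []) ++ scan P (a ∷ m ∷ M ++ b ∷ Q)      ≡⟨ cong (scan P (T ++ a ∷ m ∷ []) ++_) window ⟩
  scan P (T ++ a ∷ m ∷ []) ++ scan P (a ∷ (m ∷ M) ∷ʳ b) ++ scan P (l ∷ b ∷ Q) ∎
  where
  open ≡-Reasoning
  l = last⁺ m M
  I = init⁺ m M
  shape : ∀ R → a ∷ m ∷ M ++ b ∷ R ≡ (a ∷ I) ++ l ∷ b ∷ R
  shape R = cong (a ∷_) (init⁺-++-last⁺ m M (b ∷ R))
  window : scan P (a ∷ m ∷ M ++ b ∷ Q) ≡ scan P (a ∷ (m ∷ M) ∷ʳ b) ++ scan P (l ∷ b ∷ Q)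
  window = begin
    scan P (a ∷ m ∷ M ++ b ∷ Q)
      ≡⟨ cong (scan P) (shape Q) ⟩
    scan P ((a ∷ I) ++ l ∷ b ∷ Q)
      ≡⟨ scan-split P (a ∷ I) l b Q ⟩
    scan P ((a ∷ I) ++ l ∷ b ∷ []) ++ scan P (l ∷ b ∷ Q)
      ≡⟨ cong (λ L → scan P L ++ scan P (l ∷ b ∷ Q)) (shape []) ⟨
    scan P (a ∷ (m ∷ M) ∷ʳ b) ++ scan P (l ∷ b ∷ Q) ∎

scan-snoc : ∀ P d xs b c → scan P ((d ∷ xs) ∷ʳ b ∷ʳ c) ≡ scan P ((d ∷ xs) ∷ʳ b) ++ middle P (last⁺ d xs) b c
scan-snoc P d xs b c = begin
  scan P ((d ∷ xs) ∷ʳ b ∷ʳ c)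
    ≡⟨ cong (scan P) (trans (++-assoc (d ∷ xs) [ b ] [ c ]) (shape (b ∷ c ∷ []))) ⟩
  scan P (I ++ l ∷ b ∷ c ∷ [])
    ≡⟨ scan-∷ʳ P I l b c ⟩
  scan P (I ++ l ∷ b ∷ []) ++ middle P l b c
    ≡⟨ cong (λ L → scan P L ++ middle P l b c) (shape [ b ]) ⟨
  scan P ((d ∷ xs) ∷ʳ b) ++ middle P l b c ∎
  where
  open ≡-Reasoning
  I = init⁺ d xs
  l = last⁺ d xs
  shape : ∀ R → (d ∷ xs) ++ R ≡ I ++ l ∷ R
  shape R = init⁺-++-last⁺ d xs R

scan-drop-first : ∀ P {a b} → (∀ c → P a b c ≡ false) → ∀ L → scan P (a ∷ b ∷ L) ≡ scan P (b ∷ L)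
scan-drop-first P never [] = refl
scan-drop-first P {a} {b} never (c ∷ L) = scan-skip P a b c L (never c)

scan-head-cong : ∀ P {a a′} b R → (∀ x → P a b x ≡ P a′ b x) → scan P (a ∷ b ∷ R) ≡ scan P (a′ ∷ b ∷ R)
scan-head-cong P b [] _ = refl
scan-head-cong P b (c ∷ R) eq = cong (λ t → (if t then [ b ] else []) ++ scan P (b ∷ c ∷ R)) (eq c)

scan-last-middle-cong : ∀ P X l a b b′ → P l a b ≡ P l a b′ →
                        scan P (X ++ l ∷ a ∷ b ∷ []) ≡ scan P (X ++ l ∷ a ∷ b′ ∷ [])
scan-last-middle-cong P X l a b b′ eq = begin
  scan P (X ++ l ∷ a ∷ b ∷ [])
    ≡⟨ scan-∷ʳ P X l a b ⟩
  scan P (X ++ l ∷ a ∷ []) ++ middle P l a b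
    ≡⟨ cong (λ t → scan P (X ++ l ∷ a ∷ []) ++ (if t then [ a ] else [])) eq ⟩
  scan P (X ++ l ∷ a ∷ []) ++ middle P l a b′
    ≡⟨ scan-∷ʳ P X l a b′ ⟨
  scan P (X ++ l ∷ a ∷ b′ ∷ []) ∎
  where open ≡-Reasoning

scan-last-cong : ∀ P X a b b′ → (∀ x → P x a b ≡ P x a b′) →
                 scan P (X ++ a ∷ b ∷ []) ≡ scan P (X ++ a ∷ b′ ∷ [])
scan-last-cong P [] a b b′ _ = refl
scan-last-cong P (x ∷ X) a b b′ eq = begin
  scan P ((x ∷ X) ++ a ∷ b ∷ [])     ≡⟨ cong (scan P) (shape b) ⟩
  scan P (I ++ l ∷ a ∷ b ∷ [])       ≡⟨ scan-last-middle-cong P I l a b b′ (eq l) ⟩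
  scan P (I ++ l ∷ a ∷ b′ ∷ [])      ≡⟨ cong (scan P) (shape b′) ⟨
  scan P ((x ∷ X) ++ a ∷ b′ ∷ [])    ∎
  where
  open ≡-Reasoning
  I = init⁺ x X
  l = last⁺ x X
  shape : ∀ c → (x ∷ X) ++ a ∷ c ∷ [] ≡ I ++ l ∷ a ∷ c ∷ []
  shape c = init⁺-++-last⁺ x X (a ∷ c ∷ [])

scan-reverse : ∀ P → (∀ a b c → P a b c ≡ P c b a) → ∀ L → scan P (reverse L) ≡ reverse (scan P L)
scan-reverse P sym₃ (x ∷ y ∷ z ∷ r) = begin
  scan P (reverse (x ∷ y ∷ z ∷ r))
    ≡⟨ cong (scan P) (reverse-++ (x ∷ y ∷ z ∷ []) r) ⟩
  scan P (reverse r ++ z ∷ y ∷ x ∷ [])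
    ≡⟨ scan-∷ʳ P (reverse r) z y x ⟩
  scan P (reverse r ++ z ∷ y ∷ []) ++ middle P z y x
    ≡⟨ cong₂ _++_ (cong (scan P) (reverse-++ (y ∷ z ∷ []) r)) (cong (λ t → if t then [ y ] else []) (sym₃ x y z)) ⟨
  scan P (reverse (y ∷ z ∷ r)) ++ middle P x y z
    ≡⟨ cong (_++ middle P x y z) (scan-reverse P sym₃ (y ∷ z ∷ r)) ⟩
  reverse (scan P (y ∷ z ∷ r)) ++ middle P x y z
    ≡⟨ cong (reverse (scan P (y ∷ z ∷ r)) ++_) (reverse-middle (P x y z)) ⟩
  reverse (scan P (y ∷ z ∷ r)) ++ reverse (middle P x y z)
    ≡⟨ reverse-++ (middle P x y z) (scan P (y ∷ z ∷ r)) ⟨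
  reverse (scan P (x ∷ y ∷ z ∷ r)) ∎
  where
  open ≡-Reasoning
  reverse-middle : ∀ t → (if t then [ y ] else []) ≡ reverse (if t then [ y ] else [])
  reverse-middle true = refl
  reverse-middle false = refl
scan-reverse P sym₃ [] = refl
scan-reverse P sym₃ (x ∷ []) = refl
scan-reverse P sym₃ (x ∷ y ∷ []) = refl

record Occurrence (P : Triple) (x : ℕ) (L : List ℕ) : Set where
  constructor occurrence
  field
    before : List ℕ
    left right : ℕ
    after : List ℕ
    split : L ≡ before ++ left ∷ x ∷ right ∷ after
    holds : P left x right ≡ true

∈-scan⁺ : ∀ P xs a x c ys → P a x c ≡ true → x ∈ scan P (xs ++ a ∷ x ∷ c ∷ ys)
∈-scan⁺ P xs a x c ys eq rewrite scan-split P xs a x (c ∷ ys) | eq = ∈-++⁺ʳ (scan P (xs ++ a ∷ x ∷ [])) (here refl)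

∈-middle : ∀ {P a b c x} → x ∈ middle P a b c → x ≡ b × P a b c ≡ true
∈-middle {P} {a} {b} {c} m with P a b c
∈-middle (here refl) | true = refl , refl

Occurrence-∷ : ∀ {P x L} a → Occurrence P x L → Occurrence P x (a ∷ L)
Occurrence-∷ a (occurrence xs l r ys split holds) = occurrence (a ∷ xs) l r ys (cong (a ∷_) split) holds

∈-scan⁻ : ∀ P L {x} → x ∈ scan P L → Occurrence P x L
∈-scan⁻ P (a ∷ b ∷ c ∷ r) m =
  [ first , (λ m′ → Occurrence-∷ a (∈-scan⁻ P (b ∷ c ∷ r) m′)) ]′ (∈-++⁻ (middle P a b c) m)
  where
  first : ∀ {x} → x ∈ middle P a b c → Occurrence P x (a ∷ b ∷ c ∷ r)
  first m′ with refl , eq ← ∈-middle {P} m′ = occurrence [] a c r refl eq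

Occurrence-unique : ∀ {P x L} xs ys → Unique L → L ≡ xs ++ x ∷ ys → (o : Occurrence P x L) →
                    Occurrence.before o ∷ʳ Occurrence.left o ≡ xs × Occurrence.right o ∷ Occurrence.after o ≡ ys
Occurrence-unique {x = x} xs ys u eq (occurrence bs l r as split _) =
  Unique-split (bs ∷ʳ l) xs (subst Unique shape u) (trans (sym shape) eq)
  where
  shape = trans split (sym (++-assoc bs [ l ] (x ∷ r ∷ as)))

∈-scan-left : ∀ P {L} xs a x ys → Unique L → L ≡ xs ++ a ∷ x ∷ ys → x ∈ scan P L → ∃ λ c → P a x c ≡ true
∈-scan-left P {L} xs a x ys u eq m with o ← ∈-scan⁻ P L m
  with eqˡ , _ ← Occurrence-unique (xs ∷ʳ a) ys u (trans eq (sym (++-assoc xs [ a ] (x ∷ ys)))) o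
  with refl ← ∷ʳ-injectiveʳ (Occurrence.before o) xs eqˡ = Occurrence.right o , Occurrence.holds o

∈-scan-right : ∀ P {L} xs x c ys → Unique L → L ≡ xs ++ x ∷ c ∷ ys → x ∈ scan P L → ∃ λ a → P a x c ≡ true
∈-scan-right P {L} xs x c ys u eq m with o ← ∈-scan⁻ P L m
  with _ , eqʳ ← Occurrence-unique xs (c ∷ ys) u eq o
  with refl ← ∷-injectiveˡ eqʳ = Occurrence.left o , Occurrence.holds o

∈-scan-∷ : ∀ P h L {x} → x ∈ scan P (h ∷ L) → x ∈ L
∈-scan-∷ P h L m with ∈-scan⁻ P (h ∷ L) m
... | occurrence [] l r as refl _ = here refl
... | occurrence (_ ∷ bs) l r as refl _ = ∈-++⁺ʳ bs (there (here refl))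

scan-unique : ∀ P {L} → Unique L → Unique (scan P L)
scan-unique P {a ∷ b ∷ c ∷ r} (_ ∷ u@(b∉ ∷ _)) =
  Unique-middle-++ (All.tabulate (λ m → All.lookup b∉ (∈-scan-∷ P b (c ∷ r) m))) (scan-unique P u)
  where
  Unique-middle-++ : ∀ {ys} → All (b ≢_) ys → Unique ys → Unique (middle P a b c ++ ys)
  Unique-middle-++ b∉ys u with P a b c
  ... | true = b∉ys ∷ u
  ... | false = u
scan-unique P {[]} _ = []
scan-unique P {_ ∷ []} _ = []
scan-unique P {_ ∷ _ ∷ []} _ = []

-- Pinnacles and dells

isPinnacle isDell : Triple
isPinnacle a b c = does (a <? b) ∧ does (c <? b)
isDell a b c = does (b <? a) ∧ does (b <? c)

does-<⇒< : ∀ {m n} → does (m <? n) ≡ true → m < n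
does-<⇒< {m} {n} eq = <ᵇ⇒< m n (subst Bool.T (sym eq) tt)

isPinnacle⇒ : ∀ {a b c} → isPinnacle a b c ≡ true → a < b × c < b
isPinnacle⇒ {a} {b} {c} eq = does-<⇒< (∧-conicalˡ _ _ eq) , does-<⇒< (∧-conicalʳ _ _ eq)

isDell⇒ : ∀ {a b c} → isDell a b c ≡ true → b < a × b < c
isDell⇒ {a} {b} {c} eq = does-<⇒< (∧-conicalˡ _ _ eq) , does-<⇒< (∧-conicalʳ _ _ eq)

module _ {a b c : ℕ} where

  isPinnacle-sym : isPinnacle a b c ≡ isPinnacle c b a
  isPinnacle-sym = ∧-comm (does (a <? b)) (does (c <? b))

  isPinnacle-true : a < b → c < b → isPinnacle a b c ≡ true
  isPinnacle-true a<b c<b rewrite dec-true (a <? b) a<b | dec-true (c <? b) c<b = refl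

  isPinnacle-falseˡ : b < a → isPinnacle a b c ≡ false
  isPinnacle-falseˡ b<a rewrite dec-false (a <? b) (<-asym b<a) = refl

  isPinnacle-falseʳ : b < c → isPinnacle a b c ≡ false
  isPinnacle-falseʳ b<c rewrite dec-false (c <? b) (<-asym b<c) = ∧-zeroʳ (does (a <? b))

  isPinnacle-≡ˡ : c < b → isPinnacle a b c ≡ does (a <? b)
  isPinnacle-≡ˡ c<b rewrite dec-true (c <? b) c<b = ∧-identityʳ (does (a <? b))

  isPinnacle-≡ʳ : a < b → isPinnacle a b c ≡ does (c <? b)
  isPinnacle-≡ʳ a<b rewrite dec-true (a <? b) a<b = refl

  isDell-true : b < a → b < c → isDell a b c ≡ true
  isDell-true b<a b<c rewrite dec-true (b <? a) b<a | dec-true (b <? c) b<c = refl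

  isDell-falseˡ : a < b → isDell a b c ≡ false
  isDell-falseˡ a<b rewrite dec-false (b <? a) (<-asym a<b) = refl

  isDell-falseʳ : c < b → isDell a b c ≡ false
  isDell-falseʳ c<b rewrite dec-false (b <? c) (<-asym c<b) = ∧-zeroʳ (does (b <? a))

  isDell-≡ˡ : b < c → isDell a b c ≡ does (b <? a)
  isDell-≡ˡ b<c rewrite dec-true (b <? c) b<c = ∧-identityʳ (does (b <? a))

  isDell-≡ʳ : b < a → isDell a b c ≡ does (b <? c)
  isDell-≡ʳ b<a rewrite dec-true (b <? a) b<a = refl

dell-<-left : ∀ {L} xs a x ys → Unique L → L ≡ xs ++ a ∷ x ∷ ys → x ∈ scan isDell L → x < a
dell-<-left xs a x ys u eq m with c , h ← ∈-scan-left isDell xs a x ys u eq m = proj₁ (isDell⇒ {a} {x} {c} h)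

dell-<-right : ∀ {L} xs x c ys → Unique L → L ≡ xs ++ x ∷ c ∷ ys → x ∈ scan isDell L → x < c
dell-<-right xs x c ys u eq m with a , h ← ∈-scan-right isDell xs x c ys u eq m = proj₂ (isDell⇒ {a} {x} {c} h)

-- Ascending runs

-- y_1 … y_p followed by the last letter, which plays the role of y_{p+1}
pinnaclesAndEnd : ℕ → List ℕ → List ℕ
pinnaclesAndEnd a r = scan isPinnacle (a ∷ r) ∷ʳ last⁺ a r

module _ (a b c : ℕ) (r : List ℕ) where

  pinnaclesAndEnd-skip : isPinnacle a b c ≡ false → pinnaclesAndEnd a (b ∷ c ∷ r) ≡ pinnaclesAndEnd b (c ∷ r)
  pinnaclesAndEnd-skip eq = cong (_∷ʳ last⁺ c r) (scan-skip isPinnacle a b c r eq)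

  pinnaclesAndEnd-keep : isPinnacle a b c ≡ true → pinnaclesAndEnd a (b ∷ c ∷ r) ≡ b ∷ pinnaclesAndEnd b (c ∷ r)
  pinnaclesAndEnd-keep eq = cong (_∷ʳ last⁺ c r) (scan-keep isPinnacle a b c r eq)

record AscendingRun (L : List ℕ) (j v y : ℕ) : Set where
  constructor ascendingRun
  field
    before run after : List ℕ
    split        : L ≡ before ++ v ∷ run ++ y ∷ after
    ascending    : Linked _<_ ((v ∷ run) ∷ʳ y)
    earlierDells : ∀ {i v′} → i ≤ j → nth (scan isDell L) i ≡ just v′ → v′ ∈ before ∷ʳ v

AscendingRun-∷ : ∀ a {L j v y} → scan isDell (a ∷ L) ≡ scan isDell L → AscendingRun L j v y → AscendingRun (a ∷ L) j v y
AscendingRun-∷ a eq (ascendingRun before run after split ascending earlierDells) =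
  ascendingRun (a ∷ before) run after (cong (a ∷_) split) ascending
    (λ i≤j h → there (earlierDells i≤j (nth-≡ eq h)))

ascending-prefix : ∀ a b r {y} → a < b → Unique (a ∷ b ∷ r) → nth (pinnaclesAndEnd a (b ∷ r)) 0 ≡ just y →
                   Σ (List ℕ) λ R → Σ (List ℕ) λ Q → b ∷ r ≡ R ++ y ∷ Q × Linked _<_ ((a ∷ R) ∷ʳ y)
ascending-prefix a b [] a<b _ refl = [] , [] , refl , a<b Linked.∷ [-]
ascending-prefix a b (c ∷ r) a<b (_ ∷ u@((b≢c ∷ _) ∷ _)) h with <-cmp b c
... | tri≈ _ b≡c _ = ⊥-elim (b≢c b≡c)
... | tri> _ _ c<b with refl ← nth-≡ (pinnaclesAndEnd-keep a b c r (isPinnacle-true a<b c<b)) h =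
  [] , c ∷ r , refl , a<b Linked.∷ [-]
... | tri< b<c _ _
  with R , Q , eq , asc ← ascending-prefix b c r b<c u (nth-≡ (pinnaclesAndEnd-skip a b c r (isPinnacle-falseʳ {a = a} b<c)) h) =
  b ∷ R , Q , cong (b ∷_) eq , a<b Linked.∷ asc

-- Dells and pinnacles alternate, and a word starting with an ascent meets a pinnacle
-- before its first dell: hence the shifted index in ascending-run.
descending-run : ∀ a b r → b < a → Unique (a ∷ b ∷ r) → ∀ j {v y} → nth (scan isDell (a ∷ b ∷ r)) j ≡ just v →
                 nth (pinnaclesAndEnd a (b ∷ r)) j ≡ just y → AscendingRun (a ∷ b ∷ r) j v y
ascending-run : ∀ a b r → a < b → Unique (a ∷ b ∷ r) → ∀ j {v y} → nth (scan isDell (a ∷ b ∷ r)) j ≡ just v →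
                nth (pinnaclesAndEnd a (b ∷ r)) (suc j) ≡ just y → AscendingRun (a ∷ b ∷ r) j v y

descending-run a b (c ∷ r) b<a (_ ∷ u@((b≢c ∷ _) ∷ _)) j hv hy with <-cmp b c
... | tri≈ _ b≡c _ = ⊥-elim (b≢c b≡c)
... | tri> _ _ c<b = AscendingRun-∷ a skipD (descending-run b c r c<b u j (nth-≡ skipD hv) (nth-≡ skipP hy))
  where
  skipD = scan-skip isDell a b c r (isDell-falseʳ {a = a} c<b)
  skipP = pinnaclesAndEnd-skip a b c r (isPinnacle-falseˡ {c = c} b<a)
descending-run a b (c ∷ r) b<a (_ ∷ u) zero hv hy | tri< b<c _ _
  with refl ← nth-≡ (scan-keep isDell a b c r (isDell-true b<a b<c)) hv
  with R , Q , eq , asc ← ascending-prefix b c r b<c u (nth-≡ (pinnaclesAndEnd-skip a b c r (isPinnacle-falseˡ {c = c} b<a)) hy) =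
  ascendingRun [ a ] R Q (cong (λ t → a ∷ b ∷ t) eq) asc earlierDells
  where
  earlierDells : ∀ {i v′} → i ≤ zero → nth (scan isDell (a ∷ b ∷ c ∷ r)) i ≡ just v′ → v′ ∈ a ∷ b ∷ []
  earlierDells z≤n h with refl ← nth-≡ (scan-keep isDell a b c r (isDell-true b<a b<c)) h = there (here refl)
descending-run a b (c ∷ r) b<a (_ ∷ u) (suc j) hv hy | tri< b<c _ _
  with ascendingRun before run after split asc earlier ←
         ascending-run b c r b<c u j (nth-≡ (scan-keep isDell a b c r (isDell-true b<a b<c)) hv)
                                     (nth-≡ (pinnaclesAndEnd-skip a b c r (isPinnacle-falseˡ {c = c} b<a)) hy) =
  ascendingRun (a ∷ before) run after (cong (a ∷_) split) asc earlierDells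
  where
  keepD = scan-keep isDell a b c r (isDell-true b<a b<c)
  earlierDells : ∀ {i v′} → i ≤ suc j → nth (scan isDell (a ∷ b ∷ c ∷ r)) i ≡ just v′ →
                 v′ ∈ a ∷ before ∷ʳ _
  earlierDells {zero} _ h with refl ← nth-≡ keepD h = there (head-∈ before split)
  earlierDells {suc i} (s≤s i≤j) h = there (earlier i≤j (nth-≡ keepD h))

ascending-run a b (c ∷ r) a<b (_ ∷ u@((b≢c ∷ _) ∷ _)) j hv hy with <-cmp b c
... | tri≈ _ b≡c _ = ⊥-elim (b≢c b≡c)
... | tri< b<c _ _ = AscendingRun-∷ a skipD (ascending-run b c r b<c u j (nth-≡ skipD hv) (nth-≡ skipP hy))
  where
  skipD = scan-skip isDell a b c r (isDell-falseˡ {c = c} a<b)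
  skipP = pinnaclesAndEnd-skip a b c r (isPinnacle-falseʳ {a = a} b<c)
... | tri> _ _ c<b = AscendingRun-∷ a skipD (descending-run b c r c<b u j (nth-≡ skipD hv) (nth-≡ keepP hy))
  where
  skipD = scan-skip isDell a b c r (isDell-falseˡ {c = c} a<b)
  keepP = pinnaclesAndEnd-keep a b c r (isPinnacle-true a<b c<b)

InBlock-⊆ : ∀ {L} P v R y Q {x} → Unique L → L ≡ P ++ v ∷ R ++ y ∷ Q → InBlock v y x L → x ∈ R
InBlock-⊆ P v R y Q unique eq (xs , ms , ys , eq′ , x∈ms)
  with refl , tail-eq ← Unique-split xs P (subst Unique eq′ unique) (trans (sym eq′) eq)
  with refl , _ ← Unique-split ms R (Unique-++ʳ (xs ∷ʳ v) (subst Unique (trans eq′ (sym (∷ʳ-++ xs v _))) unique)) tail-eq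
  = x∈ms

run-interior-neighbours : ∀ Pr {L} P v R y Q {x} → Unique L → L ≡ P ++ v ∷ R ++ y ∷ Q →
                          Linked _<_ ((v ∷ R) ∷ʳ y) → x ∈ R → x ∈ scan Pr L →
                          Σ ℕ λ l → Σ ℕ λ r → Pr l x r ≡ true × l < x × x < r
run-interior-neighbours Pr {L} P v R y Q {x} unique eq asc x∈R x∈scan
  with Ra , Rb , refl ← ∈-∃++ x∈R
  with o ← ∈-scan⁻ Pr L x∈scan
  with left , right ← Occurrence-unique (P ++ v ∷ Ra) (Rb ++ y ∷ Q) unique (trans eq (++-∷-++-∷ P v Ra x Rb (y ∷ Q))) o
  with below , above ← Linked-<-around (v ∷ Ra) (subst (Linked _<_) (cong (v ∷_) (++-assoc Ra (x ∷ Rb) [ y ])) asc) =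
  Occurrence.left o , Occurrence.right o , Occurrence.holds o ,
  All.lookup below (last-∈ (Occurrence.before o) P v Ra left) ,
  All.lookup above (head-∈ Rb right)

run-interior-not-dell : ∀ {L} P v R y Q {x} → Unique L → L ≡ P ++ v ∷ R ++ y ∷ Q →
                        Linked _<_ ((v ∷ R) ∷ʳ y) → x ∈ R → x ∉ scan isDell L
run-interior-not-dell P v R y Q unique eq asc x∈R m
  with l , r , h , l<x , _ ← run-interior-neighbours isDell P v R y Q unique eq asc x∈R m =
  <-asym l<x (proj₁ (isDell⇒ {l} {_} {r} h))

run-interior-not-pinnacle : ∀ {L} P v R y Q {x} → Unique L → L ≡ P ++ v ∷ R ++ y ∷ Q →
                            Linked _<_ ((v ∷ R) ∷ʳ y) → x ∈ R → x ∉ scan isPinnacle L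
run-interior-not-pinnacle P v R y Q unique eq asc x∈R m
  with l , r , h , _ , x<r ← run-interior-neighbours isPinnacle P v R y Q unique eq asc x∈R m =
  <-asym x<r (proj₂ (isPinnacle⇒ {l} {_} {r} h))

-- The window around u

-- S = v_i … e lies between u and z; W′ and W″ are the words after the first and after
-- both reversals.
module Window (T : List ℕ) (w u s : ℕ) (S′ : List ℕ) (z : ℕ) (Q : List ℕ) where

  S S₀ : List ℕ
  S = s ∷ S′
  S₀ = init⁺ s S′

  e p : ℕ
  e = last⁺ s S′
  p = last⁺ w S₀

  W W′ W″ : List ℕ
  W  = T ++ w ∷ (u ∷ S) ++ z ∷ Q
  W′ = T ++ w ∷ (u ∷ reverse S) ++ z ∷ Q
  W″ = T ++ w ∷ (S ∷ʳ u) ++ z ∷ Q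

  S-++ : ∀ R → S ++ R ≡ S₀ ++ e ∷ R
  S-++ R = init⁺-++-last⁺ s S′ R

  W-around-e : W ≡ (T ++ w ∷ init⁺ u S₀) ++ last⁺ u S₀ ∷ e ∷ z ∷ Q
  W-around-e = begin
    T ++ w ∷ u ∷ S ++ z ∷ Q
      ≡⟨ cong (λ R → T ++ w ∷ u ∷ R) (S-++ (z ∷ Q)) ⟩
    T ++ w ∷ (u ∷ S₀) ++ e ∷ z ∷ Q
      ≡⟨ cong (λ R → T ++ w ∷ R) (init⁺-++-last⁺ u S₀ (e ∷ z ∷ Q)) ⟩
    T ++ w ∷ init⁺ u S₀ ++ last⁺ u S₀ ∷ e ∷ z ∷ Q
      ≡⟨ ++-assoc T (w ∷ init⁺ u S₀) _ ⟨
    (T ++ w ∷ init⁺ u S₀) ++ last⁺ u S₀ ∷ e ∷ z ∷ Q ∎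
    where open ≡-Reasoning

  scan-W : ∀ P → scan P W ≡ scan P (T ++ w ∷ u ∷ []) ++ scan P (w ∷ u ∷ S ∷ʳ z) ++ scan P (e ∷ z ∷ Q)
  scan-W P = scan-window P T w u S z Q

  scan-W′ : ∀ P → scan P W′ ≡ scan P (T ++ w ∷ u ∷ []) ++ scan P (w ∷ u ∷ reverse S ∷ʳ z) ++ scan P (s ∷ z ∷ Q)
  scan-W′ P = trans (scan-window P T w u (reverse S) z Q)
                    (cong (λ x → scan P (T ++ w ∷ u ∷ []) ++ scan P (w ∷ u ∷ reverse S ∷ʳ z) ++ scan P (x ∷ z ∷ Q))
                          (last⁺-reverse u s S′))

  scan-W″ : ∀ P → scan P W″ ≡ scan P (T ++ w ∷ s ∷ []) ++ scan P ((w ∷ S) ∷ʳ u ∷ʳ z) ++ scan P (u ∷ z ∷ Q)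
  scan-W″ P = trans (scan-window P T w s (S′ ∷ʳ u) z Q)
                    (cong (λ x → scan P (T ++ w ∷ s ∷ []) ++ scan P ((w ∷ S) ∷ʳ u ∷ʳ z) ++ scan P (x ∷ z ∷ Q))
                          (last⁺-++-∷ s S′ u []))

  scan-w∷S∷ʳ : ∀ P c → scan P (w ∷ S ∷ʳ c) ≡ scan P (w ∷ S) ++ middle P p e c
  scan-w∷S∷ʳ P c = begin
    scan P (w ∷ S ∷ʳ c)                   ≡⟨ cong (λ L → scan P (L ∷ʳ c)) shape ⟩
    scan P ((w ∷ S₀) ∷ʳ e ∷ʳ c)           ≡⟨ scan-snoc P w S₀ e c ⟩
    scan P ((w ∷ S₀) ∷ʳ e) ++ middle P p e c ≡⟨ cong (λ L → scan P L ++ middle P p e c) shape ⟨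
    scan P (w ∷ S) ++ middle P p e c      ∎
    where
    open ≡-Reasoning
    shape : w ∷ S ≡ (w ∷ S₀) ∷ʳ e
    shape = cong (w ∷_) (init⁺-∷ʳ-last⁺ s S′)

  module Ordered (u<w : u < w) (s<u : s < u) (e<z : e < z) (u<z : u < z) where

    s<w : s < w
    s<w = <-trans s<u u<w

    s<z : s < z
    s<z = <-trans s<u u<z

    A C B : List ℕ
    A = scan isPinnacle (T ++ w ∷ u ∷ [])
    C = scan isPinnacle (w ∷ S ∷ʳ u)
    B = scan isPinnacle (e ∷ z ∷ Q)

    pinnacles-W : isPinnacle p e u ≡ false → scan isPinnacle W ≡ A ++ C ++ B
    pinnacles-W e-not-pinnacle = trans (scan-W isPinnacle) (cong (λ M → A ++ M ++ B) (begin
      scan isPinnacle (w ∷ u ∷ S ∷ʳ z)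
        ≡⟨ scan-drop-first isPinnacle (λ _ → isPinnacle-falseˡ u<w) (S ∷ʳ z) ⟩
      scan isPinnacle (u ∷ S ∷ʳ z)
        ≡⟨ scan-head-cong isPinnacle s (S′ ∷ʳ z) (λ _ → trans (isPinnacle-falseˡ s<u) (sym (isPinnacle-falseˡ s<w))) ⟩
      scan isPinnacle (w ∷ S ∷ʳ z)
        ≡⟨ scan-w∷S∷ʳ isPinnacle z ⟩
      scan isPinnacle (w ∷ S) ++ middle isPinnacle p e z
        ≡⟨ cong (λ t → scan isPinnacle (w ∷ S) ++ (if t then [ e ] else []))
                (trans (isPinnacle-falseʳ e<z) (sym e-not-pinnacle)) ⟩
      scan isPinnacle (w ∷ S) ++ middle isPinnacle p e u
        ≡⟨ scan-w∷S∷ʳ isPinnacle u ⟨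
      C ∎))
      where open ≡-Reasoning

    pinnacles-W′ : scan isPinnacle W′ ≡ A ++ reverse C ++ B
    pinnacles-W′ = trans (scan-W′ isPinnacle) (cong₂ (λ M N → A ++ M ++ N) (begin
      scan isPinnacle (w ∷ u ∷ reverse S ∷ʳ z)
        ≡⟨ scan-drop-first isPinnacle (λ _ → isPinnacle-falseˡ u<w) (reverse S ∷ʳ z) ⟩
      scan isPinnacle (u ∷ reverse S ∷ʳ z)
        ≡⟨ cong (scan isPinnacle) (reverse-∷-∷ʳ z S u) ⟨
      scan isPinnacle (reverse (z ∷ S ∷ʳ u))
        ≡⟨ scan-reverse isPinnacle (λ a b c → isPinnacle-sym {a} {b} {c}) (z ∷ S ∷ʳ u) ⟩
      reverse (scan isPinnacle (z ∷ S ∷ʳ u))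
        ≡⟨ cong reverse (scan-head-cong isPinnacle s (S′ ∷ʳ u)
                          (λ _ → trans (isPinnacle-falseˡ s<z) (sym (isPinnacle-falseˡ s<w)))) ⟩
      reverse C ∎)
      (scan-head-cong isPinnacle z Q (λ _ → trans (isPinnacle-≡ʳ s<z) (sym (isPinnacle-≡ʳ e<z)))))
      where open ≡-Reasoning

    pinnacles-W″ : scan isPinnacle W″ ≡ A ++ C ++ B
    pinnacles-W″ = trans (scan-W″ isPinnacle) (cong₂ (λ L M → L ++ M) prefix (cong₂ _++_ window suffix))
      where
      prefix : scan isPinnacle (T ++ w ∷ s ∷ []) ≡ A
      prefix = scan-last-cong isPinnacle T w s u (λ _ → trans (isPinnacle-≡ˡ s<w) (sym (isPinnacle-≡ˡ u<w)))
      window : scan isPinnacle ((w ∷ S) ∷ʳ u ∷ʳ z) ≡ C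
      window = trans (scan-snoc isPinnacle w S u z)
                     (trans (cong (λ t → C ++ (if t then [ u ] else [])) (isPinnacle-falseʳ u<z)) (++-identityʳ C))
      suffix : scan isPinnacle (u ∷ z ∷ Q) ≡ B
      suffix = scan-head-cong isPinnacle z Q (λ _ → trans (isPinnacle-≡ʳ u<z) (sym (isPinnacle-≡ʳ e<z)))

    Ad D Bd : List ℕ
    Ad = scan isDell (T ++ w ∷ u ∷ [])
    D  = scan isDell (w ∷ S)
    Bd = scan isDell (e ∷ z ∷ Q)

    dells-W : scan isDell W ≡ Ad ++ (D ++ middle isDell p e z) ++ Bd
    dells-W = trans (scan-W isDell) (cong (λ M → Ad ++ M ++ Bd) (begin
      scan isDell (w ∷ u ∷ S ∷ʳ z)
        ≡⟨ scan-skip isDell w u s (S′ ∷ʳ z) (isDell-falseʳ {a = w} s<u) ⟩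
      scan isDell (u ∷ S ∷ʳ z)
        ≡⟨ scan-head-cong isDell s (S′ ∷ʳ z) (λ x → trans (isDell-≡ʳ {c = x} s<u) (sym (isDell-≡ʳ {c = x} s<w))) ⟩
      scan isDell (w ∷ S ∷ʳ z)
        ≡⟨ scan-w∷S∷ʳ isDell z ⟩
      D ++ middle isDell p e z ∎))
      where open ≡-Reasoning

    dells-W″ : scan isDell W″ ≡ Ad ++ ((D ++ middle isDell p e u) ++ middle isDell e u z) ++ Bd
    dells-W″ = trans (scan-W″ isDell) (cong₂ (λ L M → L ++ M) prefix (cong₂ _++_ window suffix))
      where
      prefix : scan isDell (T ++ w ∷ s ∷ []) ≡ Ad
      prefix = scan-last-cong isDell T w s u (λ x → trans (isDell-falseʳ {a = x} s<w) (sym (isDell-falseʳ {a = x} u<w)))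
      window : scan isDell ((w ∷ S) ∷ʳ u ∷ʳ z) ≡ (D ++ middle isDell p e u) ++ middle isDell e u z
      window = trans (scan-snoc isDell w S u z) (cong (_++ middle isDell e u z) (scan-w∷S∷ʳ isDell u))
      suffix : scan isDell (u ∷ z ∷ Q) ≡ Bd
      suffix = scan-head-cong isDell z Q (λ x → trans (isDell-falseˡ {c = x} u<z) (sym (isDell-falseˡ {c = x} e<z)))

Unique-perm : ∀ {n π} → IsPerm n π → Unique π
Unique-perm {n} perm = Unique-resp-↭ (↭⇒↭ₛ (↭-sym perm)) (map⁺ suc-injective (upTo⁺ n))

∈-perm⇒< : ∀ {n π x} → IsPerm n π → x ∈ π → x < suc n
∈-perm⇒< perm x∈π with _ , k∈ , refl ← ∈-map⁻ suc (∈-resp-↭ perm x∈π) = s≤s (∈-upTo⁻ k∈)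

Unique-ext : ∀ {n π} → IsPerm n π → Unique (ext n π)
Unique-ext {n} {π} perm = All.tabulate first-new ∷ ++⁺ (Unique-perm perm) ([] ∷ []) disjoint
  where
  first-new : ∀ {x} → x ∈ π ∷ʳ suc (suc n) → suc n ≢ x
  first-new m refl with ∈-++⁻ π m
  ... | inj₁ m′ = <-irrefl refl (∈-perm⇒< perm m′)
  ... | inj₂ (here eq) = <-irrefl eq (n<1+n (suc n))
  disjoint : ∀ {x} → x ∈ π × x ∈ [ suc (suc n) ] → ⊥
  disjoint (m , here refl) = <-irrefl refl (<-trans (∈-perm⇒< perm m) (n<1+n (suc n)))

∷ʳ-segment : ∀ (L X M : List ℕ) {b z} Q → L ∷ʳ b ≡ X ++ M ++ z ∷ Q →
             Σ (List ℕ) λ Y → L ≡ X ++ M ++ Y × (∀ M′ → (X ++ M′ ++ Y) ∷ʳ b ≡ X ++ M′ ++ z ∷ Q)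
∷ʳ-segment L X M {b} {z} Q eq
  with Y , zQ≡Y∷ʳb , L≡ ← ∷ʳ-≡-++-∷ L (X ++ M) Q (trans eq (sym (++-assoc X M (z ∷ Q)))) =
  Y , trans L≡ (++-assoc X M Y) , replace
  where
  replace : ∀ M′ → (X ++ M′ ++ Y) ∷ʳ b ≡ X ++ M′ ++ z ∷ Q
  replace M′ = begin
    (X ++ M′ ++ Y) ∷ʳ b   ≡⟨ ++-assoc X (M′ ++ Y) [ b ] ⟩
    X ++ (M′ ++ Y) ∷ʳ b   ≡⟨ cong (X ++_) (++-assoc M′ Y [ b ]) ⟩
    X ++ M′ ++ Y ∷ʳ b     ≡⟨ cong (λ R → X ++ M′ ++ R) zQ≡Y∷ʳb ⟨
    X ++ M′ ++ z ∷ Q      ∎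
    where open ≡-Reasoning

record Segment (n : ℕ) (π T : List ℕ) (w : ℕ) (M : List ℕ) (z : ℕ) (Q : List ℕ) : Set where
  constructor segment
  field
    X Y     : List ℕ
    split   : π ≡ X ++ M ++ Y
    replace : ∀ M′ → ext n (X ++ M′ ++ Y) ≡ T ++ w ∷ M′ ++ z ∷ Q

ext-segment : ∀ n π T w M z Q → ext n π ≡ T ++ w ∷ M ++ z ∷ Q → Segment n π T w M z Q
ext-segment n π [] w M z Q eq with refl , eq′ ← ∷-injective eq
  with Y , π≡ , replace ← ∷ʳ-segment π [] M Q eq′ = segment [] Y π≡ λ M′ → cong (suc n ∷_) (replace M′)
ext-segment n π (t ∷ T) w M z Q eq with refl , eq′ ← ∷-injective eq
  with Y , π≡ , replace ← ∷ʳ-segment π (T ∷ʳ w) M Q (trans eq′ (sym (++-assoc T [ w ] (M ++ z ∷ Q)))) =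
  segment (T ∷ʳ w) Y π≡ λ M′ → cong (suc n ∷_) (trans (replace M′) (++-assoc T [ w ] (M′ ++ z ∷ Q)))

ext-ascendingRun : ∀ {n π q vq yq} → IsPerm n π → nth (dells n π) q ≡ just vq →
                   nth (pinnacles n π ∷ʳ suc (suc n)) q ≡ just yq → AscendingRun (ext n π) q vq yq
ext-ascendingRun {n} {b ∷ π} {q} perm hv hy =
  descending-run (suc n) b (π ∷ʳ suc (suc n)) (∈-perm⇒< perm (here refl)) (Unique-ext perm) q hv
    (nth-≡ (cong (scan isPinnacle (ext n (b ∷ π)) ∷ʳ_) (sym (last⁺-++-∷ b π (suc (suc n)) []))) hy)

run-member-InA : ∀ {n σ} P v R y Q {x} → Unique (ext n σ) → ext n σ ≡ P ++ v ∷ R ++ y ∷ Q →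
                 Linked _<_ ((v ∷ R) ∷ʳ y) → x ∈ R → InA n σ v y x
run-member-InA P v R y Q unique eq asc x∈R =
  (P , R , Q , eq , x∈R) ,
  run-interior-not-dell P v R y Q unique eq asc x∈R ,
  run-interior-not-pinnacle P v R y Q unique eq asc x∈R

insertAfter-++ : ∀ u e L M → e ∉ L → insertAfter u e (L ++ e ∷ M) ≡ L ++ e ∷ u ∷ M
insertAfter-++ u e [] M _ rewrite dec-true (e ≟ e) refl = refl
insertAfter-++ u e (x ∷ L) M e∉ rewrite dec-false (x ≟ e) (λ x≡e → e∉ (here (sym x≡e))) =
  cong (x ∷_) (insertAfter-++ u e L M (λ m → e∉ (there m)))

filter-≢-++ : ∀ u X R → u ∉ X → u ∉ R → filter (λ x → ¬? (x ≟ u)) (X ++ u ∷ R) ≡ X ++ R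
filter-≢-++ u X R u∉X u∉R = begin
  filter ≢u? (X ++ u ∷ R)
    ≡⟨ filter-++ ≢u? X (u ∷ R) ⟩
  filter ≢u? X ++ filter ≢u? (u ∷ R)
    ≡⟨ cong₂ _++_ (filter-all ≢u? (≢-all u∉X)) (filter-reject ≢u? (λ u≢u → u≢u refl)) ⟩
  X ++ filter ≢u? R
    ≡⟨ cong (X ++_) (filter-all ≢u? (≢-all u∉R)) ⟩
  X ++ R ∎
  where
  open ≡-Reasoning
  ≢u? = λ x → ¬? (x ≟ u)
  ≢-all : ∀ {L} → u ∉ L → All (λ x → x ≢ u) L
  ≢-all u∉L = All.tabulate (λ m x≡u → u∉L (subst (_∈ _) x≡u m))

moveAfter-forward : ∀ X u S₀ e Y → Unique (X ++ u ∷ S₀ ++ e ∷ Y) →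
                    moveAfter u e (X ++ u ∷ S₀ ++ e ∷ Y) ≡ X ++ S₀ ++ e ∷ u ∷ Y
moveAfter-forward X u S₀ e Y unique = begin
  insertAfter u e (filter (λ x → ¬? (x ≟ u)) (X ++ u ∷ S₀ ++ e ∷ Y))
    ≡⟨ cong (insertAfter u e) (filter-≢-++ u X (S₀ ++ e ∷ Y) u∉X u∉R) ⟩
  insertAfter u e (X ++ S₀ ++ e ∷ Y)
    ≡⟨ cong (insertAfter u e) (++-assoc X S₀ (e ∷ Y)) ⟨
  insertAfter u e ((X ++ S₀) ++ e ∷ Y)
    ≡⟨ insertAfter-++ u e (X ++ S₀) Y e∉ ⟩
  (X ++ S₀) ++ e ∷ u ∷ Y
    ≡⟨ ++-assoc X S₀ (e ∷ u ∷ Y) ⟩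
  X ++ S₀ ++ e ∷ u ∷ Y ∎
  where
  open ≡-Reasoning
  u∉X = proj₁ (Unique-∉ X unique)
  u∉R = proj₂ (Unique-∉ X unique)
  e∉X∷u∷S₀ : e ∉ (X ++ u ∷ S₀)
  e∉X∷u∷S₀ = proj₁ (Unique-∉ (X ++ u ∷ S₀) (subst Unique (sym (++-assoc X (u ∷ S₀) (e ∷ Y))) unique))
  e∉ : e ∉ X ++ S₀
  e∉ m with ∈-++⁻ X m
  ... | inj₁ m′ = e∉X∷u∷S₀ (∈-++⁺ˡ m′)
  ... | inj₂ m′ = e∉X∷u∷S₀ (∈-++⁺ʳ X (there m′))

CutA-unique : ∀ {n π z v y e e′} → CutA n π z v y e → CutA n π z v y e′ → e ≡ e′
CutA-unique (cand , e<z , max) (cand′ , e′<z , max′) = ≤-antisym (max′ _ cand e<z) (max _ cand′ e′<z)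

SamePinnacles-↭ : ∀ {n σ τ} → pinnacles n σ ↭ pinnacles n τ → SamePinnacles n σ τ
SamePinnacles-↭ p x = ∈-resp-↭ p , ∈-resp-↭ (↭-sym p)

-- The two reversals

-- ext n π = T w u A₀ v_q R₁ R₂ y_q Q, where v_i S′ = A₀ v_q R₁ is the window S and the run
-- v_q … y_q is split at u into R₁ below and R₂ above it; z Q′ = R₂ y_q Q.
record Configuration (n : ℕ) (π : List ℕ) (u vi vq yq : ℕ) : Set where
  field
    T A₀ S′ R₁ R₂ Q Q′ : List ℕ
    w z : ℕ
    layout    : ext n π ≡ T ++ w ∷ u ∷ A₀ ++ vq ∷ (R₁ ++ R₂) ++ yq ∷ Q
    run-start : vi ∷ S′ ≡ A₀ ++ vq ∷ R₁
    run-end   : R₂ ++ yq ∷ Q ≡ z ∷ Q′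
    ascending : Linked _<_ ((vq ∷ R₁ ++ R₂) ∷ʳ yq)
    below     : All (_< u) R₁
    above     : All (u <_) R₂
    vi<u      : vi < u
    u<z       : u < z

first-above : ∀ {u y} R₂ Q → All (u <_) R₂ → u < y →
              Σ ℕ λ z → Σ (List ℕ) λ Q′ → R₂ ++ y ∷ Q ≡ z ∷ Q′ × u < z
first-above [] Q _ u<y = _ , Q , refl , u<y
first-above (r ∷ R₂) Q (u<r ∷ _) _ = r , R₂ ++ _ ∷ Q , refl , u<r

adjacent-run : ∀ {L} P R Q xsA ysA {u vi vq yq} → Unique L → L ≡ P ++ vq ∷ R ++ yq ∷ Q →
               vi ∈ P ∷ʳ vq → L ≡ xsA ++ u ∷ vi ∷ ysA →
               Σ (List ℕ) λ A₀ → Σ (List ℕ) λ P₂ →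
                 L ≡ xsA ++ u ∷ A₀ ++ vq ∷ R ++ yq ∷ Q × vi ∷ P₂ ≡ A₀ ∷ʳ vq
adjacent-run P R Q xsA ysA {u} {vi} {vq} {yq} unique split vi∈ adjacent
  with P₁ , P₂ , P∷ʳvq ← ∈-∃++ vi∈
  with at-vi ← trans split (trans (sym (∷ʳ-++ P vq _))
                                  (trans (cong (_++ R ++ yq ∷ Q) P∷ʳvq) (++-assoc P₁ (vi ∷ P₂) _)))
  with refl , _ ← Unique-split P₁ (xsA ∷ʳ u) (subst Unique at-vi unique)
                    (trans (sym at-vi) (trans adjacent (sym (++-assoc xsA [ u ] (vi ∷ ysA)))))
  with A₀ , vi∷P₂≡ , P≡ ← ∷ʳ-≡-++-∷ P (xsA ∷ʳ u) P₂ P∷ʳvq =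
  A₀ , P₂ , trans split (trans (cong (_++ vq ∷ R ++ yq ∷ Q) P≡) (trans (++-assoc (xsA ∷ʳ u) A₀ _) (∷ʳ-++ xsA u _))) ,
  vi∷P₂≡

configuration : ∀ {n π i q vi vq yq u} → IsPerm n π → i ≤ q →
                nth (dells n π) i ≡ just vi → nth (dells n π) q ≡ just vq →
                nth (pinnacles n π ∷ʳ suc (suc n)) q ≡ just yq →
                Adjacent u vi (ext n π) → u ≢ suc n → u < yq → Configuration n π u vi vq yq
configuration _ _ _ _ _ ([] , _ , adjacent) u≢n+1 _ = ⊥-elim (u≢n+1 (sym (∷-injectiveˡ adjacent)))
configuration {i = i} {vi = vi} {vq = vq} {u = u} perm i≤q hvi hvq hyq (x ∷ xs , ysA , adjacent) _ u<yq
  with ascendingRun P R Q split asc earlier ← ext-ascendingRun perm hvq hyq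
  with A₀ , P₂ , layout , vi∷P₂≡ ← adjacent-run P R Q (x ∷ xs) ysA (Unique-ext perm) split (earlier i≤q hvi) adjacent
  with u∉ ← proj₂ (Unique-∉ (x ∷ xs) (subst Unique layout (Unique-ext perm)))
  with R₁ , R₂ , refl , below , above ←
         split-below-above u R (Linked.tail asc) (λ m → u∉ (∈-++⁺ʳ A₀ (there (∈-++⁺ˡ m))))
  with z , Q′ , run-end , u<z ← first-above R₂ Q above u<yq =
  record
    { T = init⁺ x xs ; w = last⁺ x xs ; A₀ = A₀ ; S′ = P₂ ++ R₁ ; R₁ = R₁ ; R₂ = R₂ ; Q = Q ; Q′ = Q′ ; z = z
    ; layout    = trans layout (init⁺-++-last⁺ x xs _)
    ; run-start = trans (cong (_++ R₁) vi∷P₂≡) (++-assoc A₀ [ vq ] R₁)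
    ; run-end   = run-end
    ; ascending = asc
    ; below     = below
    ; above     = above
    ; vi<u      = dell-<-left (x ∷ xs) u vi ysA (Unique-ext perm) adjacent (nth-∈ _ i hvi)
    ; u<z       = u<z
    }

module TwoReversals {n : ℕ} {π : List ℕ} {u vi vq yq : ℕ} (q : ℕ)
  (perm : IsPerm n π) (u∉pinnacles : u ∉ pinnacles n π)
  (hvq : nth (dells n π) q ≡ just vq) (c : Configuration n π u vi vq yq) where

  open Configuration c
  open Window T w u vi S′ z Q′

  unique : Unique (ext n π)
  unique = Unique-ext perm

  ext-π : ext n π ≡ W
  ext-π = trans layout (cong (λ R → T ++ w ∷ u ∷ R) (begin
    A₀ ++ vq ∷ (R₁ ++ R₂) ++ yq ∷ Q  ≡⟨ cong (λ R → A₀ ++ vq ∷ R) (++-assoc R₁ R₂ (yq ∷ Q)) ⟩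
    A₀ ++ vq ∷ R₁ ++ R₂ ++ yq ∷ Q    ≡⟨ ++-assoc A₀ (vq ∷ R₁) _ ⟨
    (A₀ ++ vq ∷ R₁) ++ R₂ ++ yq ∷ Q  ≡⟨ cong₂ _++_ (sym run-start) run-end ⟩
    S ++ z ∷ Q′                      ∎))
    where open ≡-Reasoning

  block-π : ext n π ≡ (T ++ w ∷ u ∷ A₀) ++ vq ∷ (R₁ ++ R₂) ++ yq ∷ Q
  block-π = trans layout (sym (++-assoc T (w ∷ u ∷ A₀) _))

  run₁-shape : vq ∷ R₁ ≡ init⁺ vq R₁ ∷ʳ e
  run₁-shape = trans (init⁺-∷ʳ-last⁺ vq R₁) (cong (init⁺ vq R₁ ∷ʳ_) (sym e≡))
    where
    e≡ : e ≡ last⁺ vq R₁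
    e≡ = trans (cong (last⁺ vq) run-start) (last⁺-++-∷ vq A₀ vq R₁)

  e∈run₁ : e ∈ vq ∷ R₁
  e∈run₁ = subst (e ∈_) (sym run₁-shape) (∈-++⁺ʳ (init⁺ vq R₁) (here refl))

  around-e : All (_< e) (init⁺ vq R₁) × All (e <_) (R₂ ∷ʳ yq)
  around-e = Linked-<-around (init⁺ vq R₁) (subst (Linked _<_) shape ascending)
    where
    shape : (vq ∷ R₁ ++ R₂) ∷ʳ yq ≡ init⁺ vq R₁ ++ e ∷ R₂ ∷ʳ yq
    shape = trans (++-assoc (vq ∷ R₁) R₂ [ yq ])
                  (trans (cong (_++ R₂ ∷ʳ yq) run₁-shape) (∷ʳ-++ (init⁺ vq R₁) e (R₂ ∷ʳ yq)))

  e<z : e < z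
  e<z = All.lookup (proj₂ around-e) (head-∈ R₂ (sym run-end))

  u<w : u < w
  u<w with <-cmp u w
  ... | tri< u<w _ _ = u<w
  ... | tri≈ _ refl _ = ⊥-elim (proj₂ (Unique-∉ T (subst Unique ext-π unique)) (here refl))
  ... | tri> _ _ w<u = ⊥-elim (u∉pinnacles (subst (λ L → u ∈ scan isPinnacle L) (sym ext-π)
                          (∈-scan⁺ isPinnacle T w u vi (S′ ++ z ∷ Q′) (isPinnacle-true w<u vi<u))))

  open Ordered u<w vi<u e<z u<z

  open Segment (ext-segment n π T w (u ∷ S) z Q′ ext-π)

  π′ π″ : List ℕ
  π′ = X ++ (u ∷ reverse S) ++ Y
  π″ = X ++ (S ∷ʳ u) ++ Y

  reversal₁ : Reversal π π′
  reversal₁ = X ∷ʳ u , S , Y , (λ ()) , trans split (sym (++-assoc X [ u ] (S ++ Y))) , sym (++-assoc X [ u ] (reverse S ++ Y))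

  reversal₂ : Reversal π′ π″
  reversal₂ = X , u ∷ reverse S , Y , (λ ()) , refl , cong (λ M → X ++ M ++ Y) (sym (reverse-∷-reverse u S))

  moveAfter-e : moveAfter u e π ≡ π″
  moveAfter-e = begin
    moveAfter u e π
      ≡⟨ cong (moveAfter u e) π-shape ⟩
    moveAfter u e (X ++ u ∷ S₀ ++ e ∷ Y)
      ≡⟨ moveAfter-forward X u S₀ e Y (subst Unique π-shape (Unique-perm perm)) ⟩
    X ++ S₀ ++ e ∷ u ∷ Y
      ≡⟨ cong (X ++_) (trans (++-assoc S [ u ] Y) (S-++ (u ∷ Y))) ⟨
    π″ ∎
    where
    open ≡-Reasoning
    π-shape : π ≡ X ++ u ∷ S₀ ++ e ∷ Y
    π-shape = trans split (cong (λ R → X ++ u ∷ R) (S-++ Y))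

  vq≢u : vq ≢ u
  vq≢u refl = proj₂ (Unique-∉ (T ∷ʳ w) (subst Unique (trans layout (sym (∷ʳ-++ T w _))) unique))
                    (∈-++⁺ʳ A₀ (here refl))

  e<u : vq < u → e < u
  e<u vq<u = All.lookup (vq<u ∷ below) e∈run₁

  e≡vq : u < vq → e ≡ vq
  e≡vq u<vq with e∈run₁
  ... | here e≡vq = e≡vq
  ... | there m = ⊥-elim (<-asym u<vq (<-trans (All.lookup vq<R₁ m) (All.lookup below m)))
    where
    vq<R₁ : All (vq <_) R₁
    vq<R₁ = Allₚ.++⁻ˡ R₁ (Allₚ.++⁻ˡ (R₁ ++ R₂) (Linked-All ascending))

  -- v_i < u < v_q = e, so S has a letter before e, which is then also the letter before e in W.
  e<p : u < vq → e < p
  e<p u<vq = subst (e <_) (last⁺-init⁺ u w vi S′ vi≢e)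
    (dell-<-left (T ++ w ∷ init⁺ u S₀) (last⁺ u S₀) e (z ∷ Q′) unique (trans ext-π W-around-e)
      (subst (_∈ dells n π) (sym (e≡vq u<vq)) (nth-∈ _ q hvq)))
    where
    vi≢e : vi ≢ e
    vi≢e vi≡e = <-asym u<vq (subst (_< u) (trans vi≡e (e≡vq u<vq)) vi<u)

  e-not-pinnacle : isPinnacle p e u ≡ false
  e-not-pinnacle with <-cmp vq u
  ... | tri< vq<u _ _ = isPinnacle-falseʳ {a = p} (e<u vq<u)
  ... | tri≈ _ vq≡u _ = ⊥-elim (vq≢u vq≡u)
  ... | tri> _ _ u<vq = isPinnacle-falseˡ {c = u} (e<p u<vq)

  pinnacles-π : pinnacles n π ≡ A ++ C ++ B
  pinnacles-π = trans (cong (scan isPinnacle) ext-π) (pinnacles-W e-not-pinnacle)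

  pinnacles-π′ : pinnacles n π′ ≡ A ++ reverse C ++ B
  pinnacles-π′ = trans (cong (scan isPinnacle) (replace (u ∷ reverse S))) pinnacles-W′

  pinnacles-π″ : pinnacles n π″ ≡ A ++ C ++ B
  pinnacles-π″ = trans (cong (scan isPinnacle) (replace (S ∷ʳ u))) pinnacles-W″

  samePinnacles₁ : SamePinnacles n π π′
  samePinnacles₁ = SamePinnacles-↭ {n} {π} {π′}
    (subst₂ _↭_ (sym pinnacles-π) (sym pinnacles-π′) (++⁺ˡ A (++⁺ʳ B (↭-sym (↭-reverse C)))))

  samePinnacles₂ : SamePinnacles n π′ π″
  samePinnacles₂ = SamePinnacles-↭ {n} {π′} {π″}
    (subst₂ _↭_ (sym pinnacles-π′) (sym pinnacles-π″) (++⁺ˡ A (++⁺ʳ B (↭-reverse C))))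

  dells-π : dells n π ≡ Ad ++ (D ++ middle isDell p e z) ++ Bd
  dells-π = trans (cong (scan isDell) ext-π) dells-W

  dells-π″ : dells n π″ ≡ Ad ++ ((D ++ middle isDell p e u) ++ middle isDell e u z) ++ Bd
  dells-π″ = trans (cong (scan isDell) (replace (S ∷ʳ u))) dells-W″

  module Case-vq<u (vq<u : vq < u) where

    same-dells : dells n π″ ≡ dells n π
    same-dells = trans dells-π″ (trans (cong (λ M → Ad ++ M ++ Bd) window) (sym dells-π))
      where
      window : (D ++ middle isDell p e u) ++ middle isDell e u z ≡ D ++ middle isDell p e z
      window = begin
        (D ++ middle isDell p e u) ++ middle isDell e u z
          ≡⟨ cong (λ t → (D ++ middle isDell p e u) ++ (if t then [ u ] else [])) (isDell-falseˡ {c = z} (e<u vq<u)) ⟩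
        (D ++ middle isDell p e u) ++ []
          ≡⟨ ++-identityʳ _ ⟩
        D ++ middle isDell p e u
          ≡⟨ cong (λ t → D ++ (if t then [ e ] else []))
                  (trans (isDell-≡ˡ {a = p} (e<u vq<u)) (sym (isDell-≡ˡ {a = p} e<z))) ⟩
        D ++ middle isDell p e z ∎
        where open ≡-Reasoning

    same-pinnacles : pinnacles n π″ ≡ pinnacles n π
    same-pinnacles = trans pinnacles-π″ (sym pinnacles-π)

    ext-π″ : ext n π″ ≡ (T ++ w ∷ A₀) ++ vq ∷ (R₁ ++ u ∷ R₂) ++ yq ∷ Q
    ext-π″ = begin
      ext n π″
        ≡⟨ replace (S ∷ʳ u) ⟩
      T ++ w ∷ (S ∷ʳ u) ++ z ∷ Q′
        ≡⟨ cong (λ R → T ++ w ∷ R) (++-assoc S [ u ] (z ∷ Q′)) ⟩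
      T ++ w ∷ S ++ u ∷ z ∷ Q′
        ≡⟨ cong₂ (λ L R → T ++ w ∷ L ++ u ∷ R) run-start (sym run-end) ⟩
      T ++ w ∷ (A₀ ++ vq ∷ R₁) ++ u ∷ R₂ ++ yq ∷ Q
        ≡⟨ cong (λ R → T ++ w ∷ R) (++-assoc A₀ (vq ∷ R₁) _) ⟩
      T ++ w ∷ A₀ ++ vq ∷ R₁ ++ u ∷ R₂ ++ yq ∷ Q
        ≡⟨ cong (λ R → T ++ w ∷ A₀ ++ vq ∷ R) (++-assoc R₁ (u ∷ R₂) (yq ∷ Q)) ⟨
      T ++ w ∷ A₀ ++ vq ∷ (R₁ ++ u ∷ R₂) ++ yq ∷ Q
        ≡⟨ ++-assoc T (w ∷ A₀) _ ⟨
      (T ++ w ∷ A₀) ++ vq ∷ (R₁ ++ u ∷ R₂) ++ yq ∷ Q ∎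
      where open ≡-Reasoning

    u∈A-π″ : InA n π″ vq yq u
    u∈A-π″ = (T ++ w ∷ A₀ , R₁ ++ u ∷ R₂ , Q , ext-π″ , ∈-++⁺ʳ R₁ (here refl)) , u∉dells , u∉pins
      where
      u∉dells : u ∉ dells n π″
      u∉dells m = <-asym vi<u (dell-<-right (T ∷ʳ w) u vi (S′ ++ z ∷ Q′) unique
                    (trans ext-π (sym (++-assoc T [ w ] _))) (subst (u ∈_) same-dells m))
      u∉pins : u ∉ pinnacles n π″
      u∉pins m = u∉pinnacles (subst (u ∈_) same-pinnacles m)

    cutA : CutA n π u vq yq e
    cutA = candidate , e<u vq<u , maximal
      where
      candidate : e ≡ vq ⊎ InA n π vq yq e
      candidate with e∈run₁
      ... | here e≡vq = inj₁ e≡vq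
      ... | there m = inj₂ (run-member-InA (T ++ w ∷ u ∷ A₀) vq (R₁ ++ R₂) yq Q unique block-π ascending (∈-++⁺ˡ m))
      in-run : ∀ {e′} → e′ ≡ vq ⊎ InA n π vq yq e′ → e′ ∈ vq ∷ R₁ ++ R₂
      in-run (inj₁ refl) = here refl
      in-run (inj₂ (block , _)) = there (InBlock-⊆ (T ++ w ∷ u ∷ A₀) vq (R₁ ++ R₂) yq Q unique block-π block)
      at-most-e : ∀ {e′} → e′ ∈ vq ∷ R₁ → e′ ≤ e
      at-most-e m = ∈-∷ʳ-≤ (proj₁ around-e) (subst (_ ∈_) run₁-shape m)
      maximal : ∀ e′ → e′ ≡ vq ⊎ InA n π vq yq e′ → e′ < u → e′ ≤ e
      maximal e′ cand e′<u with in-run cand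
      ... | here refl = at-most-e (here refl)
      ... | there m with ∈-++⁻ R₁ m
      ...   | inj₁ m₁ = at-most-e (there m₁)
      ...   | inj₂ m₂ = ⊥-elim (<-asym e′<u (All.lookup above m₂))

  module Case-u<vq (u<vq : u < vq) where

    u<e : u < e
    u<e = subst (u <_) (sym (e≡vq u<vq)) u<vq

    dells-π-at-e : dells n π ≡ (Ad ++ D) ++ e ∷ Bd
    dells-π-at-e = begin
      dells n π
        ≡⟨ dells-π ⟩
      Ad ++ (D ++ middle isDell p e z) ++ Bd
        ≡⟨ cong (λ t → Ad ++ (D ++ (if t then [ e ] else [])) ++ Bd) (isDell-true (e<p u<vq) e<z) ⟩
      Ad ++ (D ∷ʳ e) ++ Bd
        ≡⟨ ++-∷ʳ-++ Ad D e Bd ⟩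
      (Ad ++ D) ++ e ∷ Bd ∎
      where open ≡-Reasoning

    dells-π″-at-u : dells n π″ ≡ (Ad ++ D) ++ u ∷ Bd
    dells-π″-at-u = begin
      dells n π″
        ≡⟨ dells-π″ ⟩
      Ad ++ ((D ++ middle isDell p e u) ++ middle isDell e u z) ++ Bd
        ≡⟨ cong₂ (λ L M → Ad ++ ((D ++ L) ++ M) ++ Bd) e-not-dell u-dell ⟩
      Ad ++ ((D ++ []) ∷ʳ u) ++ Bd
        ≡⟨ cong (λ L → Ad ++ (L ∷ʳ u) ++ Bd) (++-identityʳ D) ⟩
      Ad ++ (D ∷ʳ u) ++ Bd
        ≡⟨ ++-∷ʳ-++ Ad D u Bd ⟩
      (Ad ++ D) ++ u ∷ Bd ∎
      where
      open ≡-Reasoning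
      e-not-dell : middle isDell p e u ≡ []
      e-not-dell = cong (λ t → if t then [ e ] else []) (isDell-falseʳ {a = p} u<e)
      u-dell : middle isDell e u z ≡ [ u ]
      u-dell = cong (λ t → if t then [ u ] else []) (isDell-true u<e u<z)

    u-is-dell : nth (dells n π″) q ≡ just u
    u-is-dell = nth-≡ (sym dells-π″-at-u)
      (nth-replace (Ad ++ D) q u (subst Unique dells-π-at-e (scan-unique isDell unique))
        (nth-≡ dells-π-at-e (subst (λ x → nth (dells n π) q ≡ just x) (sym (e≡vq u<vq)) hvq)))

lemma3 : (n : ℕ) (π : List ℕ) → IsPerm n π →
    (i q : ℕ) → 1 ≤ i → i ≤ q → q ≤ suc (length (pinnacles n π)) →
    (vi vq yq u : ℕ) →
    dellNo n π i ≡ just vi → dellNo n π q ≡ just vq → pinNo n π q ≡ just yq →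
    vi ≤ vq →
    Adjacent u vi (ext n π) → u ∉ pinnacles n π → u ≢ suc n → u < yq →
    Σ (List ℕ) λ π′ → Σ (List ℕ) λ π″ →
      Reversal π π′ × SamePinnacles n π π′ ×
      Reversal π′ π″ × SamePinnacles n π′ π″ ×
      (vq < u → ∀ e → CutA n π u vq yq e →
        π″ ≡ moveAfter u e π × dellNo n π″ q ≡ just vq × pinNo n π″ q ≡ just yq × InA n π″ vq yq u) ×
      (u < vq → π″ ≡ moveAfter u vq π × dellNo n π″ q ≡ just u)
lemma3 n π perm (suc i) (suc q) _ (s≤s i≤q) _ vi vq yq u hvi hvq hyq _ adjacent u∉pinnacles u≢n+1 u<yq =
  π′ , π″ , reversal₁ , samePinnacles₁ , reversal₂ , samePinnacles₂ , below-u , above-u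
  where
  open TwoReversals q perm u∉pinnacles hvq (configuration perm i≤q hvi hvq hyq adjacent u≢n+1 u<yq)

  below-u : vq < u → ∀ e′ → CutA n π u vq yq e′ →
            π″ ≡ moveAfter u e′ π × dellNo n π″ (suc q) ≡ just vq ×
            pinNo n π″ (suc q) ≡ just yq × InA n π″ vq yq u
  below-u vq<u e′ cut with refl ← CutA-unique (Case-vq<u.cutA vq<u) cut =
    sym moveAfter-e , nth-≡ (sym same-dells) hvq , nth-≡ (cong (_∷ʳ suc (suc n)) (sym same-pinnacles)) hyq , u∈A-π″
    where open Case-vq<u vq<u

  above-u : u < vq → π″ ≡ moveAfter u vq π × dellNo n π″ (suc q) ≡ just u
  above-u u<vq = trans (sym moveAfter-e) (cong (λ x → moveAfter u x π) (e≡vq u<vq)) , u-is-dell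
    where open Case-u<vq u<vq
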